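{- $C^{\mathrm{comp}}(f) = \Theta(\log_2 \chi^{\mathrm{geom}}(f))$; that is, there exist absolute constants $c_1, c_2 > 0$ such that for every $n \geq 1$ and every function $f : \{0,1\}^n \times \{0,1\}^n \to \{0,1\}$, $c_1 \log_2 \chi^{\mathrm{geom}}(f) \leq C^{\mathrm{comp}}(f) \leq c_2 \log_2 \chi^{\mathrm{geom}}(f)$.
   Context: Order $\{0,1\}^n$ lexicographically, i.e. compare strings as binary representations of integers in $\{0,\dots,2^n-1\}$ with the first bit most significant; write $[a,b] = \{z \in \{0,1\}^n : a \leq z \leq b\}$. A geometric rectangle is a set of the form $[a_{\min}, a_{\max}] \times [b_{\min}, b_{\max}] \subseteq \{0,1\}^n \times \{0,1\}^n$. It is $f$-monochromatic if $f$ is constant on it. $\chi^{\mathrm{geom}}(f)$ is the minimum number of pairwise disjoint $f$-monochromatic geometric rectangles whose union is $\{0,1\}^n \times \{0,1\}^n$. For $z \in \{0,1\}^n$, the comparison function $\theta_z : \{0,1\}^n \to \{0,1\}$ is defined by $\theta_z(y) = 1$ if and only if $y \geq z$. A comparison protocol is a rooted tree in which every internal vertex has exactly two children (via outgoing edges labeled $0$ and $1$), is owned either by Alice or by Bob, and is labeled by a function which is either some $\theta_z$ ($z \in \{0,1\}^n$) or the constant $0$ function; leaves are labeled by outputs in $\{0,1\}$. On input $(x,y)$ (Alice holds $x$, Bob holds $y$), one starts at the root; at an internal vertex owned by Alice (resp. Bob) its function is evaluated on $x$ (resp. $y$) and the edge labeled by the result is followed; the output is the label of the leaf reached. The protocol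 computes $f$ if this output equals $f(x,y)$ for all $(x,y)$. Its cost is its depth, the maximum number of edges on a root-to-leaf path. $C^{\mathrm{comp}}(f)$ is the minimum cost of a comparison protocol computing $f$. -}

module Defs where

open import Data.Bool using (Bool; true; false; if_then_else_)
open import Data.Nat using (ℕ; zero; suc; _+_; _*_; _^_; _≤_; _⊔_)
open import Data.Nat.Properties using (_≤?_)
open import Data.Vec using (Vec; []; _∷_)
open import Data.Fin using (Fin)
open import Data.Product using (Σ; ∃; _×_)
open import Relation.Nullary.Decidable using (⌊_⌋)
open import Relation.Binary.PropositionalEquality using (_≡_)

BitStr : ℕ → Set
BitStr n = Vec Bool n

val : ∀ {n} → BitStr n → ℕ
val {zero}  []       = 0
val {suc n} (b ∷ bs) = (if b then 2 ^ n else 0) + val bs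

-- Lexicographic order on {0,1}^n.
_≤ₗ_ : ∀ {n} → BitStr n → BitStr n → Set
a ≤ₗ b = val a ≤ val b

_∈[_,_] : ∀ {n} → BitStr n → BitStr n → BitStr n → Set
z ∈[ a , b ] = (a ≤ₗ z) × (z ≤ₗ b)

record GeomRect (n : ℕ) : Set where
  constructor rect
  field
    amin amax bmin bmax : BitStr n

_∈R_ : ∀ {n} → BitStr n × BitStr n → GeomRect n → Set
_∈R_ (x Data.Product., y) R = (x ∈[ GeomRect.amin R , GeomRect.amax R ])
                            × (y ∈[ GeomRect.bmin R , GeomRect.bmax R ])

Fun : ℕ → Set
Fun n = BitStr n → BitStr n → Bool

Monochromatic : ∀ {n} → Fun n → GeomRect n → Set
Monochromatic {n} f R = Σ Bool λ c → ∀ (x y : BitStr n) → (x Data.Product., y) ∈R R → f x y ≡ c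

record GeomPartition {n : ℕ} (f : Fun n) (k : ℕ) : Set where
  field
    rects    : Fin k → GeomRect n
    mono     : ∀ i → Monochromatic f (rects i)
    disjoint : ∀ i j (x y : BitStr n) → (x Data.Product., y) ∈R rects i
               → (x Data.Product., y) ∈R rects j → i ≡ j
    covers   : ∀ (x y : BitStr n) → ∃ λ i → (x Data.Product., y) ∈R rects i

IsChiGeom : ∀ {n} → Fun n → ℕ → Set
IsChiGeom f k = GeomPartition f k × (∀ m → GeomPartition f m → k ≤ m)

data Player : Set where
  alice bob : Player

data Label (n : ℕ) : Set where
  θ     : BitStr n → Label n
  const0 : Label n

evalLabel : ∀ {n} → Label n → BitStr n → Bool
evalLabel (θ z)  y = ⌊ val z ≤? val y ⌋
evalLabel const0 y = false

-- node o ℓ t₀ t₁ : t₀ is the child along edge 0, t₁ along edge 1.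
data Protocol (n : ℕ) : Set where
  leaf : Bool → Protocol n
  node : Player → Label n → Protocol n → Protocol n → Protocol n

run : ∀ {n} → Protocol n → BitStr n → BitStr n → Bool
run (leaf b) x y = b
run (node alice ℓ t₀ t₁) x y = if evalLabel ℓ x then run t₁ x y else run t₀ x y
run (node bob   ℓ t₀ t₁) x y = if evalLabel ℓ y then run t₁ x y else run t₀ x y

depth : ∀ {n} → Protocol n → ℕ
depth (leaf _) = 0
depth (node _ _ t₀ t₁) = suc (depth t₀ ⊔ depth t₁)

Computes : ∀ {n} → Protocol n → Fun n → Set
Computes {n} P f = ∀ (x y : BitStr n) → run P x y ≡ f x y

IsCcomp : ∀ {n} → Fun n → ℕ → Set
IsCcomp f d = (Σ _ λ P → Computes P f × depth P ≡ d)
            × (∀ P → Computes P f → d ≤ depth P)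

{-# OPTIONS --safe #-}
module Submission where

-- A comparison protocol of depth d has at most 2^d leaves, and the inputs reaching a
-- leaf form a box cut out by threshold comparisons, i.e. a geometric rectangle; so the
-- leaves partition the inputs into at most 2^d monochromatic rectangles.
-- Conversely, given a partition into k rectangles, Alice rounds x down to the largest
-- lower corner a_min ≤ x of a rectangle, and Bob rounds y down likewise, each by binary
-- search over the sorted corners in ⌈log₂ k⌉ comparisons. The rounded point (r, s) lies
-- in the rectangle containing (x, y), so f r s = f x y. Hence k ≤ 2^d ≤ k^4.

open import Defs
open import Data.Bool using (Bool; true; false; if_then_else_)
open import Data.Fin using (Fin; zero; toℕ; fromℕ<; _↑ˡ_; _↑ʳ_; splitAt)
open import Data.Fin.Properties
  using (toℕ<n; toℕ-fromℕ<; fromℕ<-toℕ; splitAt-↑ˡ; splitAt-↑ʳ; splitAt⁻¹-↑ˡ; splitAt⁻¹-↑ʳ)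
open import Data.List using (List; length; lookup; tabulate)
open import Data.List.Properties using (length-tabulate)
open import Data.List.Membership.Propositional using (_∈_)
open import Data.List.Membership.Propositional.Properties using (∈-tabulate⁺)
open import Data.List.Relation.Unary.Any using (index)
open import Data.List.Relation.Unary.Any.Properties using (lookup-index)
open import Data.List.Relation.Binary.Permutation.Propositional using (↭-sym)
open import Data.List.Relation.Binary.Permutation.Propositional.Properties using (∈-resp-↭; ↭-length)
import Data.List.Sort as Sort
open import Data.List.Relation.Unary.Sorted.TotalOrder.Properties using (lookup-mono-≤)
open import Data.Nat
  using (ℕ; zero; suc; _+_; _*_; _^_; _≤_; _<_; _⊔_; _⊓_; _∸_; z≤n; s≤s; pred; NonZero; >-nonZero)
open import Data.Nat.Properties
open import Data.Product using (Σ; _×_; _,_; proj₁; proj₂; ∃-syntax)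
open import Data.Sum using (inj₁; inj₂; [_,_]′)
open import Data.Vec using (_∷_; []; replicate)
open import Function using (_∘_)
open import Level using (0ℓ)
open import Relation.Binary.Bundles using (DecTotalOrder)
import Relation.Binary.Construct.On as On
open import Relation.Nullary using (Dec; yes; no; contradiction)
open import Relation.Nullary.Reflects using (Reflects; ofʸ; ofⁿ)
open import Relation.Binary.PropositionalEquality
  using (_≡_; refl; sym; trans; cong; subst; subst₂; module ≡-Reasoning)

private variable
  n : ℕ

val<2^n : (z : BitStr n) → val z < 2 ^ n
val<2^n {zero}  []           = s≤s z≤n
val<2^n {suc n} (false ∷ bs) = ≤-trans (val<2^n bs) (m≤m+n (2 ^ n) (2 ^ n + 0))
val<2^n {suc n} (true ∷ bs)  = +-monoʳ-< (2 ^ n) (≤-trans (val<2^n bs) (m≤m+n (2 ^ n) 0))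

threshold : Label n → ℕ
threshold (θ z)        = val z
threshold {n} const0   = 2 ^ n

threshold≤2^n : (ℓ : Label n) → threshold ℓ ≤ 2 ^ n
threshold≤2^n (θ z)  = <⇒≤ (val<2^n z)
threshold≤2^n const0 = ≤-refl

evalLabel-reflects : (ℓ : Label n) (z : BitStr n) →
                     Reflects (threshold ℓ ≤ val z) (evalLabel ℓ z)
evalLabel-reflects (θ z') z with val z' ≤? val z
... | yes z'≤z = ofʸ z'≤z
... | no  z'≰z = ofⁿ z'≰z
evalLabel-reflects const0 z = ofⁿ (<⇒≱ (val<2^n z))

input : Player → BitStr n → BitStr n → BitStr n
input alice x y = x
input bob   x y = y

run-node : ∀ p (ℓ : Label n) t₀ t₁ x y →
           run (node p ℓ t₀ t₁) x y
             ≡ (if evalLabel ℓ (input p x y) then run t₁ x y else run t₀ x y)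
run-node alice ℓ t₀ t₁ x y = refl
run-node bob   ℓ t₀ t₁ x y = refl

-- Leaf boxes are built from half-open intervals of values val z, which may be empty;
-- `endpoints` turns them back into geometric rectangles.
record Interval : Set where
  constructor [_,_⟩
  field
    lo hi : ℕ

record _∈ᵢ_ (z : BitStr n) (I : Interval) : Set where
  constructor between
  open Interval I
  field
    lo≤ : lo ≤ val z
    <hi : val z < hi

_∩_ : Interval → Interval → Interval
[ a , b ⟩ ∩ [ c , d ⟩ = [ a ⊔ c , b ⊓ d ⟩

∈-∩⁺ : ∀ {z : BitStr n} I J → z ∈ᵢ I → z ∈ᵢ J → z ∈ᵢ (I ∩ J)
∈-∩⁺ [ a , b ⟩ [ c , d ⟩ (between a≤z z<b) (between c≤z z<d) =
  between (⊔-lub a≤z c≤z) (⊓-glb z<b z<d)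

∈-∩⁻ : ∀ {z : BitStr n} I J → z ∈ᵢ (I ∩ J) → z ∈ᵢ I × z ∈ᵢ J
∈-∩⁻ [ a , b ⟩ [ c , d ⟩ (between a⊔c≤z z<b⊓d) =
  between (m⊔n≤o⇒m≤o a c a⊔c≤z) (m≤n⊓o⇒m≤n b d z<b⊓d) ,
  between (m⊔n≤o⇒n≤o a c a⊔c≤z) (m≤n⊓o⇒m≤o b d z<b⊓d)

halfLine : Label n → Bool → Interval
halfLine     ℓ false = [ 0 , threshold ℓ ⟩
halfLine {n} ℓ true  = [ threshold ℓ , 2 ^ n ⟩

∈-halfLine⁺ : (ℓ : Label n) (z : BitStr n) → z ∈ᵢ halfLine ℓ (evalLabel ℓ z)
∈-halfLine⁺ ℓ z with evalLabel ℓ z | evalLabel-reflects ℓ z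
... | true  | ofʸ ℓ≤z = between ℓ≤z (val<2^n z)
... | false | ofⁿ ℓ≰z = between z≤n (≰⇒> ℓ≰z)

∈-halfLine⁻ : ∀ (ℓ : Label n) z b → z ∈ᵢ halfLine ℓ b → evalLabel ℓ z ≡ b
∈-halfLine⁻ ℓ z b z∈ with evalLabel ℓ z | evalLabel-reflects ℓ z
∈-halfLine⁻ ℓ z true  _               | true  | _        = refl
∈-halfLine⁻ ℓ z true  (between ℓ≤z _) | false | ofⁿ ℓ≰z = contradiction ℓ≤z ℓ≰z
∈-halfLine⁻ ℓ z false (between _ z<ℓ) | true  | ofʸ ℓ≤z = contradiction ℓ≤z (<⇒≱ z<ℓ)
∈-halfLine⁻ ℓ z false _               | false | _        = refl

Box : Set
Box = Interval × Interval

_∈ᵦ_ : BitStr n × BitStr n → Box → Set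
(x , y) ∈ᵦ (A , B) = x ∈ᵢ A × y ∈ᵢ B

restrict : Player → Interval → Box → Box
restrict alice J (A , B) = A ∩ J , B
restrict bob   J (A , B) = A , B ∩ J

∈-restrict⁺ : ∀ p J R {x y : BitStr n} →
              (x , y) ∈ᵦ R → input p x y ∈ᵢ J → (x , y) ∈ᵦ restrict p J R
∈-restrict⁺ alice J (A , B) (x∈A , y∈B) x∈J = ∈-∩⁺ A J x∈A x∈J , y∈B
∈-restrict⁺ bob   J (A , B) (x∈A , y∈B) y∈J = x∈A , ∈-∩⁺ B J y∈B y∈J

∈-restrict⁻ : ∀ p J R {x y : BitStr n} →
              (x , y) ∈ᵦ restrict p J R → (x , y) ∈ᵦ R × input p x y ∈ᵢ J
∈-restrict⁻ alice J (A , B) (x∈A∩J , y∈B) =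
  let x∈A , x∈J = ∈-∩⁻ A J x∈A∩J in (x∈A , y∈B) , x∈J
∈-restrict⁻ bob   J (A , B) (x∈A , y∈B∩J) =
  let y∈B , y∈J = ∈-∩⁻ B J y∈B∩J in (x∈A , y∈B) , y∈J

-- The leaf partition of a protocol

leaves : Protocol n → ℕ
leaves (leaf _)         = 1
leaves (node _ _ t₀ t₁) = leaves t₀ + leaves t₁

leaves≤2^depth : (P : Protocol n) → leaves P ≤ 2 ^ depth P
leaves≤2^depth (leaf _)         = ≤-refl
leaves≤2^depth (node _ _ t₀ t₁) = +-mono-≤
  (≤-trans (leaves≤2^depth t₀) (^-monoʳ-≤ 2 (m≤m⊔n (depth t₀) (depth t₁))))
  (≤-trans (leaves≤2^depth t₁)
           (≤-trans (^-monoʳ-≤ 2 (m≤n⊔m (depth t₀) (depth t₁))) (m≤m+n _ 0)))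

leafIndex : (P : Protocol n) → BitStr n → BitStr n → Fin (leaves P)
leafIndex (leaf _)         x y = zero
leafIndex (node p ℓ t₀ t₁) x y =
  if evalLabel ℓ (input p x y)
  then leaves t₀ ↑ʳ leafIndex t₁ x y
  else leafIndex t₀ x y ↑ˡ leaves t₁

leafOutput : (P : Protocol n) → Fin (leaves P) → Bool
leafOutput (leaf b)         i = b
leafOutput (node _ _ t₀ t₁) i = [ leafOutput t₀ , leafOutput t₁ ]′ (splitAt (leaves t₀) i)

leafBox : (P : Protocol n) → Box → Fin (leaves P) → Box
leafBox (leaf _)         R i = R
leafBox (node p ℓ t₀ t₁) R i =
  [ leafBox t₀ (restrict p (halfLine ℓ false) R)
  , leafBox t₁ (restrict p (halfLine ℓ true) R)
  ]′ (splitAt (leaves t₀) i)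

run≡leafOutput : (P : Protocol n) (x y : BitStr n) → run P x y ≡ leafOutput P (leafIndex P x y)
run≡leafOutput (leaf b) x y = refl
run≡leafOutput (node p ℓ t₀ t₁) x y rewrite run-node p ℓ t₀ t₁ x y
  with evalLabel ℓ (input p x y)
... | true  rewrite splitAt-↑ʳ (leaves t₀) (leaves t₁) (leafIndex t₁ x y) =
  run≡leafOutput t₁ x y
... | false rewrite splitAt-↑ˡ (leaves t₀) (leafIndex t₀ x y) (leaves t₁) =
  run≡leafOutput t₀ x y

∈-leafBox⁺ : (P : Protocol n) (R : Box) {x y : BitStr n} →
             (x , y) ∈ᵦ R → (x , y) ∈ᵦ leafBox P R (leafIndex P x y)
∈-leafBox⁺ (leaf _) R xy∈R = xy∈R
∈-leafBox⁺ (node p ℓ t₀ t₁) R {x} {y} xy∈R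
  with evalLabel ℓ (input p x y) | ∈-restrict⁺ p _ R xy∈R (∈-halfLine⁺ ℓ (input p x y))
... | true  | xy∈R′ rewrite splitAt-↑ʳ (leaves t₀) (leaves t₁) (leafIndex t₁ x y) =
  ∈-leafBox⁺ t₁ _ xy∈R′
... | false | xy∈R′ rewrite splitAt-↑ˡ (leaves t₀) (leafIndex t₀ x y) (leaves t₁) =
  ∈-leafBox⁺ t₀ _ xy∈R′

∈-leafBox⁻ : (P : Protocol n) (R : Box) {x y : BitStr n} (i : Fin (leaves P)) →
             (x , y) ∈ᵦ leafBox P R i → (x , y) ∈ᵦ R × leafIndex P x y ≡ i
∈-leafBox⁻ (leaf _) R zero xy∈R = xy∈R , refl
∈-leafBox⁻ (node p ℓ t₀ t₁) R {x} {y} i xy∈ with splitAt (leaves t₀) i in split≡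
... | inj₁ j with ∈-leafBox⁻ t₀ _ j xy∈
...   | xy∈R′ , index≡j with ∈-restrict⁻ p _ R xy∈R′
...     | xy∈R , u∈J rewrite ∈-halfLine⁻ ℓ (input p x y) false u∈J =
          xy∈R , trans (cong (_↑ˡ leaves t₁) index≡j) (splitAt⁻¹-↑ˡ split≡)
∈-leafBox⁻ (node p ℓ t₀ t₁) R {x} {y} i xy∈ | inj₂ j with ∈-leafBox⁻ t₁ _ j xy∈
...   | xy∈R′ , index≡j with ∈-restrict⁻ p _ R xy∈R′
...     | xy∈R , u∈J rewrite ∈-halfLine⁻ ℓ (input p x y) true u∈J =
          xy∈R , trans (cong (leaves t₀ ↑ʳ_) index≡j) (splitAt⁻¹-↑ʳ split≡)

toBits : (n : ℕ) → ℕ → BitStr n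
toBits zero    v = []
toBits (suc n) v with 2 ^ n ≤? v
... | yes _ = true  ∷ toBits n (v ∸ 2 ^ n)
... | no  _ = false ∷ toBits n v

val-toBits : ∀ n {v} → v < 2 ^ n → val (toBits n v) ≡ v
val-toBits zero    {zero}  _         = refl
val-toBits zero    {suc _} (s≤s ())
val-toBits (suc n) {v} v<2^[1+n] with 2 ^ n ≤? v
... | yes 2^n≤v = trans (cong (2 ^ n +_) (val-toBits n v∸2^n<2^n)) (m+[n∸m]≡n 2^n≤v)
  where
  v∸2^n<2^n : v ∸ 2 ^ n < 2 ^ n
  v∸2^n<2^n = m<n+o⇒m∸n<o v (2 ^ n) {{m^n≢0 2 n}}
                (subst (v <_) (cong (2 ^ n +_) (+-identityʳ (2 ^ n))) v<2^[1+n])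
... | no  2^n≰v = val-toBits n (≰⇒> 2^n≰v)

-- An empty interval gets the endpoints 10…0 > 00…0, which needs at least one bit.
endpoints : (m : ℕ) → Interval → BitStr (suc m) × BitStr (suc m)
endpoints m [ lo , hi ⟩ with lo <? hi ⊓ 2 ^ suc m
... | yes _ = toBits (suc m) lo , toBits (suc m) (pred (hi ⊓ 2 ^ suc m))
... | no  _ = true ∷ replicate m false , replicate (suc m) false

val-toBits-endpoints : ∀ m {lo hi} → let h = hi ⊓ 2 ^ suc m in lo < h →
                       val (toBits (suc m) lo) ≡ lo × val (toBits (suc m) (pred h)) ≡ pred h
val-toBits-endpoints m {lo} {hi} lo<h =
  val-toBits (suc m) (<-≤-trans lo<h (m⊓n≤n hi _)) ,
  val-toBits (suc m) (subst (_≤ 2 ^ suc m) (sym (suc-pred h {{h≢0}})) (m⊓n≤n hi _))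
  where
  h : ℕ
  h = hi ⊓ 2 ^ suc m
  h≢0 : NonZero h
  h≢0 = >-nonZero (≤-<-trans z≤n lo<h)

∈-endpoints⁺ : ∀ m I (z : BitStr (suc m)) →
               z ∈ᵢ I → z ∈[ proj₁ (endpoints m I) , proj₂ (endpoints m I) ]
∈-endpoints⁺ m [ lo , hi ⟩ z (between lo≤z z<hi) with lo <? hi ⊓ 2 ^ suc m
... | no  lo≮h = contradiction (≤-<-trans lo≤z (⊓-glb z<hi (val<2^n z))) lo≮h
... | yes lo<h =
  let a≡lo , b≡pred[h] = val-toBits-endpoints m lo<h
  in subst (_≤ val z) (sym a≡lo) lo≤z ,
     subst (val z ≤_) (sym b≡pred[h]) (suc[m]≤n⇒m≤pred[n] (⊓-glb z<hi (val<2^n z)))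

∈-endpoints⁻ : ∀ m I (z : BitStr (suc m)) →
               z ∈[ proj₁ (endpoints m I) , proj₂ (endpoints m I) ] → z ∈ᵢ I
∈-endpoints⁻ m [ lo , hi ⟩ z (a≤z , z≤b) with lo <? hi ⊓ 2 ^ suc m
... | no  _    = contradiction (≤-trans a≤z z≤b) (<⇒≱ (m<n+m _ (m^n>0 2 m)))
... | yes lo<h =
  let a≡lo , b≡pred[h] = val-toBits-endpoints m lo<h
  in between (subst (_≤ val z) a≡lo a≤z)
             (<-≤-trans (m≤pred[n]⇒suc[m]≤n {{h≢0}} (subst (val z ≤_) b≡pred[h] z≤b))
                        (m⊓n≤m hi _))
  where
  h≢0 : NonZero (hi ⊓ 2 ^ suc m)
  h≢0 = >-nonZero (≤-<-trans z≤n lo<h)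

boxRect : (m : ℕ) → Box → GeomRect (suc m)
boxRect m (A , B) =
  rect (proj₁ (endpoints m A)) (proj₂ (endpoints m A)) (proj₁ (endpoints m B)) (proj₂ (endpoints m B))

∈-boxRect⁺ : ∀ m R {x y : BitStr (suc m)} → (x , y) ∈ᵦ R → (x , y) ∈R boxRect m R
∈-boxRect⁺ m (A , B) (x∈A , y∈B) = ∈-endpoints⁺ m A _ x∈A , ∈-endpoints⁺ m B _ y∈B

∈-boxRect⁻ : ∀ m R {x y : BitStr (suc m)} → (x , y) ∈R boxRect m R → (x , y) ∈ᵦ R
∈-boxRect⁻ m (A , B) (x∈A , y∈B) = ∈-endpoints⁻ m A _ x∈A , ∈-endpoints⁻ m B _ y∈B

leafPartition : ∀ {m} {f : Fun (suc m)} (P : Protocol (suc m)) →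
                Computes P f → GeomPartition f (leaves P)
leafPartition {m} {f} P P-computes = record
  { rects    = rects
  ; mono     = λ i → leafOutput P i , λ x y xy∈ → begin
                 f x y                             ≡⟨ P-computes x y ⟨
                 run P x y                         ≡⟨ run≡leafOutput P x y ⟩
                 leafOutput P (leafIndex P x y)    ≡⟨ cong (leafOutput P) (index≡ i x y xy∈) ⟩
                 leafOutput P i                    ∎
  ; disjoint = λ i j x y xy∈i xy∈j → trans (sym (index≡ i x y xy∈i)) (index≡ j x y xy∈j)
  ; covers   = λ x y → leafIndex P x y , ∈-boxRect⁺ m _
                 (∈-leafBox⁺ P whole (between z≤n (val<2^n x) , between z≤n (val<2^n y)))
  }
  where
  whole : Box
  whole = [ 0 , 2 ^ suc m ⟩ , [ 0 , 2 ^ suc m ⟩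
  rects : Fin (leaves P) → GeomRect (suc m)
  rects i = boxRect m (leafBox P whole i)
  index≡ : ∀ i x y → (x , y) ∈R rects i → leafIndex P x y ≡ i
  index≡ i x y xy∈ = proj₂ (∈-leafBox⁻ P whole i (∈-boxRect⁻ m _ xy∈))
  open ≡-Reasoning

chiGeom≤2^cComp : ∀ {m} {f : Fun (suc m)} {k d} → IsChiGeom f k → IsCcomp f d → k ≤ 2 ^ d
chiGeom≤2^cComp (_ , minimal) ((P , P-computes , refl) , _) =
  ≤-trans (minimal _ (leafPartition P P-computes)) (leaves≤2^depth P)

-- Binary search

search : Player → (ℕ → Label n) → (e lo : ℕ) → (ℕ → Protocol n) → Protocol n
search p g zero    lo c = c lo
search p g (suc e) lo c =
  node p (g (lo + 2 ^ e)) (search p g e lo c) (search p g e (lo + 2 ^ e) c)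

search-depth : ∀ p (g : ℕ → Label n) e lo c {D} →
               (∀ j → depth (c j) ≤ D) → depth (search p g e lo c) ≤ e + D
search-depth p g zero    lo c c≤D = c≤D lo
search-depth p g (suc e) lo c c≤D =
  s≤s (⊔-lub (search-depth p g e lo c c≤D) (search-depth p g e (lo + 2 ^ e) c c≤D))

search-run : ∀ p (g : ℕ → Label n) e lo c x y → let u = input p x y in
             threshold (g lo) ≤ val u → val u < threshold (g (lo + 2 ^ e)) →
             ∃[ j ] threshold (g j) ≤ val u × val u < threshold (g (suc j))
                  × run (search p g e lo c) x y ≡ run (c j) x y
search-run p g zero lo c x y lo≤u u<hi =
  lo , lo≤u , subst (λ i → val (input p x y) < threshold (g i)) (+-comm lo 1) u<hi , refl
search-run p g (suc e) lo c x y lo≤u u<hi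
  rewrite run-node p (g (lo + 2 ^ e)) (search p g e lo c) (search p g e (lo + 2 ^ e) c) x y
  with evalLabel (g (lo + 2 ^ e)) (input p x y) | evalLabel-reflects (g (lo + 2 ^ e)) (input p x y)
... | true  | ofʸ mid≤u = search-run p g e (lo + 2 ^ e) c x y mid≤u
                            (subst (λ i → val (input p x y) < threshold (g i)) (lo+2^[1+e]≡ lo e) u<hi)
  where
  lo+2^[1+e]≡ : ∀ lo e → lo + 2 ^ suc e ≡ lo + 2 ^ e + 2 ^ e
  lo+2^[1+e]≡ lo e =
    trans (cong (λ t → lo + (2 ^ e + t)) (+-identityʳ (2 ^ e))) (sym (+-assoc lo _ _))
... | false | ofⁿ mid≰u = search-run p g e lo c x y lo≤u (≰⇒> mid≰u)

-- A protocol from a partition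

module Ladder {n : ℕ} (T : List (BitStr n)) where

  valOrder : DecTotalOrder 0ℓ 0ℓ 0ℓ
  valOrder = On.decTotalOrder ≤-decTotalOrder (val {n})

  open Sort valOrder using (sort; sort-↭; sort-↗)

  sorted : List (BitStr n)
  sorted = sort T

  -- Past the last corner the ladder continues with const0, whose threshold 2^n exceeds
  -- every input; this is the upper sentinel of the binary search.
  rung : (j : ℕ) → Dec (j < length sorted) → Label n
  rung j (yes j<len) = θ (lookup sorted (fromℕ< j<len))
  rung j (no  _)     = const0

  ladder : ℕ → Label n
  ladder j = rung j (j <? length sorted)

  rung-mono : ∀ {i j} (i? : Dec (i < length sorted)) (j? : Dec (j < length sorted)) →
              i ≤ j → threshold (rung i i?) ≤ threshold (rung j j?)
  rung-mono i?          (no  _)     _   = threshold≤2^n (rung _ i?)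
  rung-mono (no  i≮len) (yes j<len) i≤j = contradiction (≤-<-trans i≤j j<len) i≮len
  rung-mono (yes i<len) (yes j<len) i≤j =
    lookup-mono-≤ (DecTotalOrder.totalOrder valOrder) (sort-↗ T) {fromℕ< i<len} {fromℕ< j<len}
      (subst₂ _≤_ (sym (toℕ-fromℕ< i<len)) (sym (toℕ-fromℕ< j<len)) i≤j)

  ladder-mono : ∀ {i j} → i ≤ j → threshold (ladder i) ≤ threshold (ladder j)
  ladder-mono = rung-mono (_ <? length sorted) (_ <? length sorted)

  length-sorted : length sorted ≡ length T
  length-sorted = ↭-length (sort-↭ T)

  ladder-top : ∀ {j} → length T ≤ j → ladder j ≡ const0
  ladder-top {j} len≤j with j <? length sorted
  ... | no  _     = refl
  ... | yes j<len = contradiction (subst (_≤ j) (sym length-sorted) len≤j) (<⇒≱ j<len)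

  ladder-∈ : ∀ {a} → a ∈ T → ∃[ j ] ladder j ≡ θ a
  ladder-∈ {a} a∈T =
    toℕ i , trans (rung-index (toℕ i <? length sorted)) (cong θ (sym (lookup-index a∈sorted)))
    where
    a∈sorted : a ∈ sorted
    a∈sorted = ∈-resp-↭ (↭-sym (sort-↭ T)) a∈T
    i : Fin (length sorted)
    i = index a∈sorted
    rung-index : (i? : Dec (toℕ i < length sorted)) → rung (toℕ i) i? ≡ θ (lookup sorted i)
    rung-index (yes i<len) = cong (θ ∘ lookup sorted) (fromℕ<-toℕ i i<len)
    rung-index (no  i≮len) = contradiction (toℕ<n i) i≮len

-- point const0 is a junk value; val-point rules it out wherever point is used.
point : Label n → BitStr n
point     (θ z)  = z
point {n} const0 = replicate n false

val-point : (ℓ : Label n) {z : BitStr n} → threshold ℓ ≤ val z → val (point ℓ) ≡ threshold ℓ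
val-point (θ _)  _        = refl
val-point const0 {z} ℓ≤z = contradiction ℓ≤z (<⇒≱ (val<2^n z))

open Ladder using (ladder; ladder-mono; ladder-top; ladder-∈)

roundDown : Player → List (BitStr n) → ℕ → (BitStr n → Protocol n) → Protocol n
roundDown p T e c = search p (ladder T) e 0 (c ∘ point ∘ ladder T)

roundDown-depth : ∀ p (T : List (BitStr n)) e c {D} →
                  (∀ r → depth (c r) ≤ D) → depth (roundDown p T e c) ≤ e + D
roundDown-depth p T e c c≤D = search-depth p (ladder T) e 0 _ (c≤D ∘ point ∘ ladder T)

roundDown-run : ∀ p (T : List (BitStr n)) e c x y {a} → let u = input p x y in
                length T ≤ 2 ^ e → a ∈ T → val a ≤ val u →
                ∃[ r ] val a ≤ val r × val r ≤ val u × run (roundDown p T e c) x y ≡ run (c r) x y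
roundDown-run p T e c x y {a} len≤2^e a∈T a≤u =
  let j , j≤u , u<j+1 , run≡ = search-run p (ladder T) e 0 _ x y bottom≤u u<top
      -- a is on rung j₀ ≤ j, because rung (suc j) already lies above u ≥ a
      j₀≤j = ≮⇒≥ λ j<j₀ → <⇒≱ u<j+1
               (≤-trans (ladder-mono T {suc j} {j₀} j<j₀) (subst (_≤ u) a≡j₀ a≤u))
      r≡j  = val-point (ladder T j) j≤u
  in point (ladder T j) ,
     subst (val a ≤_) (sym r≡j)
       (subst (_≤ threshold (ladder T j)) (sym a≡j₀) (ladder-mono T {j₀} {j} j₀≤j)) ,
     subst (_≤ u) (sym r≡j) j≤u ,
     run≡
  where
  u : ℕ
  u = val (input p x y)
  j₀ : ℕ
  j₀ = proj₁ (ladder-∈ T a∈T)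
  a≡j₀ : val a ≡ threshold (ladder T j₀)
  a≡j₀ = cong threshold (sym (proj₂ (ladder-∈ T a∈T)))
  bottom≤u : threshold (ladder T 0) ≤ u
  bottom≤u = ≤-trans (ladder-mono T {0} {j₀} z≤n) (subst (_≤ u) a≡j₀ a≤u)
  u<top : u < threshold (ladder T (0 + 2 ^ e))
  u<top rewrite ladder-top T len≤2^e = val<2^n (input p x y)

module _ {n} {f : Fun n} {k} (G : GeomPartition f k) where
  open GeomPartition G
  open GeomRect

  corners : (GeomRect n → BitStr n) → List (BitStr n)
  corners corner = tabulate (corner ∘ rects)

  bobPhase : ℕ → BitStr n → Protocol n
  bobPhase e r = roundDown bob (corners bmin) e (leaf ∘ f r)

  cornerProtocol : ℕ → Protocol n
  cornerProtocol e = roundDown alice (corners amin) e (bobPhase e)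

  cornerProtocol-depth : ∀ e → depth (cornerProtocol e) ≤ e + (e + 0)
  cornerProtocol-depth e =
    roundDown-depth alice (corners amin) e (bobPhase e) λ r →
    roundDown-depth bob   (corners bmin) e (leaf ∘ f r) λ _ → z≤n

  cornerProtocol-computes : ∀ e → k ≤ 2 ^ e → Computes (cornerProtocol e) f
  cornerProtocol-computes e k≤2^e x y =
    let i , (amin≤x , x≤amax) , (bmin≤y , y≤bmax) = covers x y
        r , amin≤r , r≤x , run≡ᵣ =
          roundDown-run alice (corners amin) e (bobPhase e) x y (len≤2^e amin) (∈-tabulate⁺ i) amin≤x
        s , bmin≤s , s≤y , run≡ₛ =
          roundDown-run bob (corners bmin) e (leaf ∘ f r) x y (len≤2^e bmin) (∈-tabulate⁺ i) bmin≤y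
        c , constant = mono i
    in begin
      run (cornerProtocol e) x y ≡⟨ trans run≡ᵣ run≡ₛ ⟩
      f r s                      ≡⟨ constant r s ((amin≤r , ≤-trans r≤x x≤amax)
                                                 , (bmin≤s , ≤-trans s≤y y≤bmax)) ⟩
      c                          ≡⟨ constant x y ((amin≤x , x≤amax) , (bmin≤y , y≤bmax)) ⟨
      f x y                      ∎
    where
    open ≡-Reasoning
    len≤2^e : ∀ corner → length (corners corner) ≤ 2 ^ e
    len≤2^e corner = subst (_≤ 2 ^ e) (sym (length-tabulate _)) k≤2^e

-- e is ⌈log₂ k⌉; the crude upper bound k * k is all the final estimate needs.
pow2-between : ∀ k → 1 ≤ k → ∃[ e ] k ≤ 2 ^ e × 2 ^ e ≤ k * k
pow2-between (suc zero)    _ = 0 , ≤-refl , ≤-refl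
pow2-between (suc (suc k)) _ with pow2-between (suc k) (s≤s z≤n)
... | e , k+1≤2^e , 2^e≤[k+1]² with suc (suc k) ≤? 2 ^ e
...   | yes k+2≤2^e = e , k+2≤2^e , ≤-trans 2^e≤[k+1]² (*-mono-≤ (n≤1+n (suc k)) (n≤1+n (suc k)))
...   | no  k+2≰2^e =
  suc e ,
  subst (λ t → suc (suc k) ≤ 2 * t) (sym 2^e≡k+1)
    (+-mono-≤ (s≤s z≤n) (≤-reflexive (sym (+-identityʳ (suc k))))) ,
  subst (λ t → 2 * t ≤ suc (suc k) * suc (suc k)) (sym 2^e≡k+1)
    (*-mono-≤ {2} {suc (suc k)} (s≤s (s≤s z≤n)) (n≤1+n (suc k)))
  where
  2^e≡k+1 : 2 ^ e ≡ suc k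
  2^e≡k+1 = ≤-antisym (≤-pred (≰⇒> k+2≰2^e)) k+1≤2^e

partition-size≥1 : ∀ {n} {f : Fun n} {k} → GeomPartition f k → 1 ≤ k
partition-size≥1 {n} {k = zero} G with GeomPartition.covers G (replicate n false) (replicate n false)
... | () , _
partition-size≥1 {k = suc k} G = s≤s z≤n

2^cComp≤chiGeom^4 : ∀ {n} {f : Fun n} {k d} → IsChiGeom f k → IsCcomp f d → 2 ^ d ≤ k ^ 4
2^cComp≤chiGeom^4 {k = k} {d} (G , _) (_ , minimal) =
  let e , k≤2^e , 2^e≤k*k = pow2-between k (partition-size≥1 G)
      d≤2e = ≤-trans (minimal _ (cornerProtocol-computes G e k≤2^e)) (cornerProtocol-depth G e)
  in begin
    2 ^ d           ≤⟨ ^-monoʳ-≤ 2 d≤2e ⟩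
    2 ^ (2 * e)     ≡⟨ cong (2 ^_) (*-comm 2 e) ⟩
    2 ^ (e * 2)     ≡⟨ ^-*-assoc 2 e 2 ⟨
    (2 ^ e) ^ 2     ≤⟨ ^-monoˡ-≤ 2 2^e≤k*k ⟩
    (k * k) ^ 2     ≡⟨ cong (λ t → (k * t) ^ 2) (*-identityʳ k) ⟨
    (k ^ 2) ^ 2     ≡⟨ ^-*-assoc k 2 2 ⟩
    k ^ 4           ∎
  where open ≤-Reasoning

mainTheorem6 : Σ ℕ λ p₁ → Σ ℕ λ q₁ → Σ ℕ λ p₂ → Σ ℕ λ q₂ →
    (1 ≤ p₁) × (1 ≤ q₁) × (1 ≤ p₂) × (1 ≤ q₂) ×
    (∀ (n : ℕ) → 1 ≤ n → (f : Fun n) → (k d : ℕ) →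
      IsChiGeom f k → IsCcomp f d →
      (k ^ p₁ ≤ 2 ^ (q₁ * d)) × (2 ^ (q₂ * d) ≤ k ^ p₂))
mainTheorem6 = 1 , 1 , 4 , 1 , ≤-refl , ≤-refl , s≤s z≤n , ≤-refl , bounds
  where
  bounds : ∀ n → 1 ≤ n → (f : Fun n) → (k d : ℕ) → IsChiGeom f k → IsCcomp f d →
           (k ^ 1 ≤ 2 ^ (1 * d)) × (2 ^ (1 * d) ≤ k ^ 4)
  bounds (suc _) _ _ k d χ C =
    subst₂ _≤_ (sym (^-identityʳ k)) 2^d≡2^[1*d] (chiGeom≤2^cComp χ C) ,
    subst (_≤ k ^ 4) 2^d≡2^[1*d] (2^cComp≤chiGeom^4 χ C)
    where
    2^d≡2^[1*d] : 2 ^ d ≡ 2 ^ (1 * d)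
    2^d≡2^[1*d] = cong (2 ^_) (sym (*-identityˡ d))
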